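{- Let $H=(V,\mathcal{E})$ be a finite hypergraph and $\mathcal{L}=\{L_v\}_{v\in V}$ a family of finite sets of positive integers. Consider the following procedure: while $V\neq\emptyset$: let $c=\min\bigcup_{v\in V}L_v$; let $V^c=\{v\in V: c\in L_v\}$; choose a set $U\subseteq V^c$ that is an independent set of the induced hypergraph $H[V^c]$; set $f(x)=c$ for every $x\in U$; for every $v\in V^c\setminus U$ replace $L_v$ by $L_v\setminus\{c\}$; replace $V$ by $V\setminus U$. (Here the current $V$ and current lists are used in each iteration, and $H[V^c]$ is taken with respect to the original hypergraph.) If during the execution no list of a still-uncolored vertex becomes empty (so that the procedure terminates with every vertex colored), then the output $f$ is a unique-maximum coloring of $H$ with $f(v)\in L_v$ (original lists) for every $v\in V$.
   Context: For a hypergraph $H=(V,\mathcal{E})$ and $V'\subseteq V$, the induced sub-hypergraph is $H[V']=(V',\{S\cap V' : S\in\mathcal{E}\})$. A set $U\subseteq V$ is independent in $H$ if for every $S\in\mathcal{E}$ with $|S|\ge 2$ we have $S\not\subseteq U$. A coloring $C\colon V\to\mathbb{Z}_{>0}$ is a unique-maximum coloring if for every hyperedge $S\in\mathcal{E}$, the maximum color $\max_{v\in S}C(v)$ is attained by exactly one vertex of $S$. -}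

module Defs where

open import Data.Nat using (ℕ; _≤_; _<_; _≟_)
open import Data.Fin using (Fin)
open import Data.Bool using (Bool; true; false; _∧_; if_then_else_)
open import Data.Maybe using (Maybe; just; nothing)
open import Data.List using (List; []; filter; map)
open import Data.Product using (Σ; _×_; _,_; ∃)
open import Data.Vec using (tabulate)
open import Data.Fin.Subset using (Subset; _∈_; _∉_; _⊆_; _∩_; _─_; ∣_∣; Nonempty; ⊤; ⊥)
open import Data.Fin.Subset.Properties using (_∈?_)
import Data.List.Membership.Propositional as LM
open import Data.List.Membership.DecPropositional _≟_ using () renaming (_∈?_ to _∈ℕ?_)
open import Relation.Nullary using (¬_; does; ¬?)
open import Relation.Binary.PropositionalEquality using (_≡_; _≢_)
open import Relation.Binary.Construct.Closure.ReflexiveTransitive using (Star)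

Hypergraph : ℕ → Set
Hypergraph n = List (Subset n)

induced : ∀ {n} → Hypergraph n → Subset n → Hypergraph n
induced H V' = map (λ S → S ∩ V') H

Independent : ∀ {n} → Hypergraph n → Subset n → Set
Independent H U = ∀ S → S LM.∈ H → 2 ≤ ∣ S ∣ → ¬ (S ⊆ U)

IsUniqueMaxColoring : ∀ {n} → Hypergraph n → (Fin n → ℕ) → Set
IsUniqueMaxColoring H C =
  ∀ S → S LM.∈ H →
    Σ (Fin _) λ v → v ∈ S
      × (∀ w → w ∈ S → C w ≤ C v)
      × (∀ w → w ∈ S → C w ≡ C v → w ≡ v)

record State (n : ℕ) : Set where
  constructor ⟨_,_,_⟩
  field
    verts : Subset n
    lists : Fin n → List ℕ
    col   : Fin n → Maybe ℕ
open State public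

IsMinColour : ∀ {n} → Subset n → (Fin n → List ℕ) → ℕ → Set
IsMinColour V Ls c =
  (Σ (Fin _) λ v → v ∈ V × c LM.∈ Ls v)
  × (∀ v → v ∈ V → ∀ d → d LM.∈ Ls v → c ≤ d)

Vc : ∀ {n} → Subset n → (Fin n → List ℕ) → ℕ → Subset n
Vc V Ls c = tabulate (λ v → does (v ∈? V) ∧ does (c ∈ℕ? Ls v))

removeColour : ℕ → List ℕ → List ℕ
removeColour c = filter (λ d → ¬? (d ≟ c))

data Step {n} (H : Hypergraph n) : State n → State n → Set where
  step : ∀ {V Ls f} (c : ℕ) (U : Subset n) →
    Nonempty V →
    IsMinColour V Ls c →
    U ⊆ Vc V Ls c →
    Independent (induced H (Vc V Ls c)) U →
    Step H ⟨ V , Ls , f ⟩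
           ⟨ V ─ U
           , (λ v → if does (v ∈? Vc V Ls c) ∧ (if does (v ∈? U) then false else true)
                      then removeColour c (Ls v) else Ls v)
           , (λ x → if does (x ∈? U) then just c else f x) ⟩

NoEmptyList : ∀ {n} → State n → Set
NoEmptyList s = ∀ v → v ∈ verts s → lists s v ≢ []

GoodStep : ∀ {n} → Hypergraph n → State n → State n → Set
GoodStep H s s' = Step H s s' × NoEmptyList s'

initial : ∀ {n} → (Fin n → List ℕ) → State n
initial L = ⟨ ⊤ , L , (λ _ → nothing) ⟩

CompleteRun : ∀ {n} → Hypergraph n → (Fin n → List ℕ) → (Fin n → Maybe ℕ) → Set
CompleteRun H L f =
  NoEmptyList (initial L) ×
  Σ (State _) λ s → Star (GoodStep H) (initial L) s × verts s ≡ ⊥ × col s ≡ f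

-- Throughout the run, every vertex already removed from V carries a colour from its
-- original list that is smaller than every colour still in the lists of vertices in V,
-- because colours are assigned in increasing order c. When the last vertices of a
-- hyperedge S are coloured in some round c, these vertices receive the largest colour
-- on S, and since S ∩ V^c ⊆ U with U independent in H[V^c] there is only one of them.
-- Once all of S is coloured, its colours never change again.
module Submission where

open import Defs
open import Data.Nat using (ℕ; _≤_; _<_; _≟_)
open import Data.Nat.Properties using (≤-reflexive; <⇒≤; ≤∧≢⇒<; <-irrefl; ≤-<-trans)
open import Data.Fin using (Fin)
import Data.Fin as Fin
open import Data.Bool using (true; false; _∧_; if_then_else_)
open import Data.Maybe using (Maybe; just; fromMaybe)
open import Data.Product using (Σ; _×_; _,_; proj₁; proj₂)
open import Data.Sum using (_⊎_; inj₁; inj₂)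
open import Data.Empty using (⊥-elim)
open import Data.List using (List)
open import Data.List.Relation.Unary.All using (All)
import Data.List.Relation.Unary.All as All
import Data.List.Membership.Propositional as LM
open import Data.List.Membership.Propositional.Properties using (∈-map⁺; ∈-filter⁻)
open import Data.List.Membership.DecPropositional _≟_ using () renaming (_∈?_ to _∈ℕ?_)
open import Data.Vec using (_∷_; here; there)
open import Data.Vec.Properties using (lookup∘tabulate; []=⇒lookup; lookup⇒[]=)
open import Data.Fin.Subset using (Subset; Nonempty; _∈_; _∉_; _⊆_; _∩_; _─_; _-_; ⁅_⁆; ∣_∣; inside; outside)
open import Data.Fin.Subset.Properties
  using (_∈?_; ∉⊥; ∈⊤; x∈p∩q⁺; x∈p∩q⁻; x∈p∧x∉q⇒x∈p─q; p─q⊆p; nonempty?;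
         x∈⁅y⁆⇒x≡y; ∣⁅x⁆∣≡1; p⊆q⇒∣p∣≤∣q∣; x∈p∧x≢y⇒x∈p-y; x∈p⇒∣p-x∣<∣p∣)
open import Relation.Nullary using (Dec; yes; no; does; ¬?)
open import Relation.Binary.PropositionalEquality using (_≡_; _≢_; refl; sym; trans; cong; subst; subst₂)
open import Relation.Binary.Construct.Closure.ReflexiveTransitive using (Star; ε; _◅_)
open import Function using (_∘_)

x∈p─q⇒x∉q : ∀ {n} (p q : Subset n) {x} → x ∈ p ─ q → x ∉ q
x∈p─q⇒x∉q (inside ∷ p) (outside ∷ q) here ()
x∈p─q⇒x∉q (_ ∷ p) (_ ∷ q) (there x∈p─q) (there x∈q) = x∈p─q⇒x∉q p q x∈p─q x∈q

two≤∣p∣ : ∀ {n} {p : Subset n} {v w} → v ∈ p → w ∈ p → v ≢ w → 2 ≤ ∣ p ∣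
two≤∣p∣ {p = p} {v} {w} v∈p w∈p v≢w = ≤-<-trans one≤∣p-v∣ (x∈p⇒∣p-x∣<∣p∣ v∈p)
  where
  ⁅w⁆⊆p-v : ⁅ w ⁆ ⊆ p - v
  ⁅w⁆⊆p-v x∈⁅w⁆ with x∈⁅y⁆⇒x≡y w x∈⁅w⁆
  ... | refl = x∈p∧x≢y⇒x∈p-y w∈p (v≢w ∘ sym)
  one≤∣p-v∣ : 1 ≤ ∣ p - v ∣
  one≤∣p-v∣ = subst (_≤ ∣ p - v ∣) (∣⁅x⁆∣≡1 w) (p⊆q⇒∣p∣≤∣q∣ ⁅w⁆⊆p-v)

∈Vc⁺ : ∀ {n} {V : Subset n} {Ls c v} → v ∈ V → c LM.∈ Ls v → v ∈ Vc V Ls c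
∈Vc⁺ {V = V} {Ls} {c} {v} v∈V c∈Ls =
  lookup⇒[]= v _ (trans (lookup∘tabulate _ v) (both-true (v ∈? V) (c ∈ℕ? Ls v)))
  where
  both-true : (v∈V? : Dec (v ∈ V)) (c∈Ls? : Dec (c LM.∈ Ls v)) → does v∈V? ∧ does c∈Ls? ≡ true
  both-true (yes _) (yes _) = refl
  both-true (no v∉V) _ = ⊥-elim (v∉V v∈V)
  both-true (yes _) (no c∉Ls) = ⊥-elim (c∉Ls c∈Ls)

∈Vc⁻ : ∀ {n} {V : Subset n} {Ls c v} → v ∈ Vc V Ls c → v ∈ V × c LM.∈ Ls v
∈Vc⁻ {V = V} {Ls} {c} {v} v∈Vc =
  both (v ∈? V) (c ∈ℕ? Ls v) (trans (sym (lookup∘tabulate _ v)) ([]=⇒lookup v∈Vc))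
  where
  both : ∀ {A B : Set} (a : Dec A) (b : Dec B) → does a ∧ does b ≡ true → A × B
  both (yes a) (yes b) _ = a , b

recolour : ∀ {n} → Subset n → ℕ → (Fin n → Maybe ℕ) → Fin n → Maybe ℕ
recolour U c f x = if does (x ∈? U) then just c else f x

strikeColour : ∀ {n} → Subset n → Subset n → ℕ → (Fin n → List ℕ) → Fin n → List ℕ
strikeColour W U c Ls v =
  if does (v ∈? W) ∧ (if does (v ∈? U) then false else true) then removeColour c (Ls v) else Ls v

module _ {n} {U : Subset n} {c : ℕ} {f : Fin n → Maybe ℕ} {x : Fin n} where

  recolour-∈ : x ∈ U → recolour U c f x ≡ just c
  recolour-∈ x∈U with x ∈? U
  ... | yes _ = refl
  ... | no x∉U = ⊥-elim (x∉U x∈U)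

  recolour-∉ : x ∉ U → recolour U c f x ≡ f x
  recolour-∉ x∉U with x ∈? U
  ... | yes x∈U = ⊥-elim (x∉U x∈U)
  ... | no _ = refl

module _ {n} {W U : Subset n} {c : ℕ} {Ls : Fin n → List ℕ} {v : Fin n} {d : ℕ} where

  strikeColour-⊆ : d LM.∈ strikeColour W U c Ls v → d LM.∈ Ls v
  strikeColour-⊆ d∈ with v ∈? W | v ∈? U
  ... | yes _ | yes _ = d∈
  ... | yes _ | no _ = proj₁ (∈-filter⁻ (λ e → ¬? (e ≟ c)) {xs = Ls v} d∈)
  ... | no _ | _ = d∈

  strikeColour-≢ : v ∈ W → v ∉ U → d LM.∈ strikeColour W U c Ls v → d ≢ c
  strikeColour-≢ v∈W v∉U d∈ with v ∈? W | v ∈? U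
  ... | yes _ | yes v∈U = ⊥-elim (v∉U v∈U)
  ... | yes _ | no _ = proj₂ (∈-filter⁻ (λ e → ¬? (e ≟ c)) {xs = Ls v} d∈)
  ... | no v∉W | _ = ⊥-elim (v∉W v∈W)

HasUniqueMax : ∀ {n} → (Fin n → ℕ) → Subset n → Set
HasUniqueMax C S = Σ (Fin _) λ v → v ∈ S
  × (∀ w → w ∈ S → C w ≤ C v)
  × (∀ w → w ∈ S → C w ≡ C v → w ≡ v)

HasUniqueMax-cong : ∀ {n} {C D : Fin n → ℕ} {S : Subset n} →
  (∀ {w} → w ∈ S → C w ≡ D w) → HasUniqueMax C S → HasUniqueMax D S
HasUniqueMax-cong C≡D (v , v∈S , ≤top , top-unique) =
  v , v∈S
  , (λ w w∈S → subst₂ _≤_ (C≡D w∈S) (C≡D v∈S) (≤top w w∈S))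
  , (λ w w∈S Dw≡Dv → top-unique w w∈S (trans (C≡D w∈S) (trans Dw≡Dv (sym (C≡D v∈S)))))

-- 0 is a junk value: the invariant only reads colourOf at vertices already coloured.
colourOf : Maybe ℕ → ℕ
colourOf = fromMaybe 0

record Invariant {n} (H : Hypergraph n) (L : Fin n → List ℕ) (s : State n) : Set where
  field
    coloured     : ∀ {x} → x ∉ verts s → col s x ≡ just (colourOf (col s x))
    colour∈list  : ∀ {x} → x ∉ verts s → colourOf (col s x) LM.∈ L x
    lists⊆       : ∀ {v d} → d LM.∈ lists s v → d LM.∈ L v
    colour<lists : ∀ {x y d} → x ∉ verts s → y ∈ verts s → d LM.∈ lists s y →
                   colourOf (col s x) < d
    uniqueMax    : ∀ {S} → S LM.∈ H → (∀ {x} → x ∈ S → x ∉ verts s) →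
                   HasUniqueMax (colourOf ∘ col s) S

initial-invariant : ∀ {n} {H : Hypergraph n} {L : Fin n → List ℕ} →
  (∀ S → S LM.∈ H → Nonempty S) → Invariant H L (initial L)
initial-invariant edges-nonempty = record
  { coloured     = λ x∉⊤ → ⊥-elim (x∉⊤ ∈⊤)
  ; colour∈list  = λ x∉⊤ → ⊥-elim (x∉⊤ ∈⊤)
  ; lists⊆       = λ d∈ → d∈
  ; colour<lists = λ x∉⊤ → ⊥-elim (x∉⊤ ∈⊤)
  ; uniqueMax    = λ {S} S∈H S-done → ⊥-elim (S-done (proj₂ (edges-nonempty S S∈H)) ∈⊤)
  }

module Round {n} {H : Hypergraph n} {L : Fin n → List ℕ}
  {V : Subset n} {Ls : Fin n → List ℕ} {f : Fin n → Maybe ℕ} {c : ℕ} {U : Subset n}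
  (inv : Invariant H L ⟨ V , Ls , f ⟩)
  (c-lower : ∀ v → v ∈ V → ∀ d → d LM.∈ Ls v → c ≤ d)
  (U⊆Vc : U ⊆ Vc V Ls c)
  (U-indep : Independent (induced H (Vc V Ls c)) U)
  where

  open Invariant inv

  W : Subset n
  W = Vc V Ls c

  V′ : Subset n
  V′ = V ─ U

  Ls′ : Fin n → List ℕ
  Ls′ = strikeColour W U c Ls

  f′ : Fin n → Maybe ℕ
  f′ = recolour U c f

  ∈W⁺ : ∀ {v} → v ∈ V → c LM.∈ Ls v → v ∈ W
  ∈W⁺ = ∈Vc⁺ {V = V} {Ls}

  ∈W⁻ : ∀ {v} → v ∈ W → v ∈ V × c LM.∈ Ls v
  ∈W⁻ = ∈Vc⁻ {V = V} {Ls}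

  recoloured : ∀ {x} → x ∈ U → f′ x ≡ just c
  recoloured = recolour-∈ {U = U} {c} {f}

  unrecoloured : ∀ {x} → x ∉ U → f′ x ≡ f x
  unrecoloured = recolour-∉ {U = U} {c} {f}

  struck⊆ : ∀ {v d} → d LM.∈ Ls′ v → d LM.∈ Ls v
  struck⊆ = strikeColour-⊆ {W = W} {U} {c} {Ls}

  struck≢ : ∀ {v d} → v ∈ W → v ∉ U → d LM.∈ Ls′ v → d ≢ c
  struck≢ = strikeColour-≢ {W = W} {U} {c} {Ls}

  U⊆V : U ⊆ V
  U⊆V = proj₁ ∘ ∈W⁻ ∘ U⊆Vc

  removed : ∀ {x} → x ∉ V′ → x ∈ U ⊎ x ∉ V
  removed {x} x∉V′ with x ∈? U
  ... | yes x∈U = inj₁ x∈U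
  ... | no x∉U = inj₂ (λ x∈V → x∉V′ (x∈p∧x∉q⇒x∈p─q x∈V x∉U))

  -- c ≤ d by minimality of c, and d ≢ c because c was struck from the lists of V^c ─ U.
  above-c : ∀ {y d} → y ∈ V′ → d LM.∈ Ls′ y → c < d
  above-c {y} {d} y∈V′ d∈Ls′ = ≤∧≢⇒< (c-lower y y∈V d d∈Ls) (d≢c ∘ sym)
    where
    y∈V = p─q⊆p V U y∈V′
    d∈Ls = struck⊆ d∈Ls′
    d≢c : d ≢ c
    d≢c d≡c = struck≢ (∈W⁺ y∈V (subst (LM._∈ Ls y) d≡c d∈Ls)) (x∈p─q⇒x∉q V U y∈V′) d∈Ls′ d≡c

  coloured′ : ∀ {x} → x ∉ V′ → f′ x ≡ just (colourOf (f′ x))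
  coloured′ x∉V′ with removed x∉V′
  ... | inj₁ x∈U rewrite recoloured x∈U = refl
  ... | inj₂ x∉V rewrite unrecoloured (x∉V ∘ U⊆V) = coloured x∉V

  colour∈list′ : ∀ {x} → x ∉ V′ → colourOf (f′ x) LM.∈ L x
  colour∈list′ x∉V′ with removed x∉V′
  ... | inj₁ x∈U rewrite recoloured x∈U = lists⊆ (proj₂ (∈W⁻ (U⊆Vc x∈U)))
  ... | inj₂ x∉V rewrite unrecoloured (x∉V ∘ U⊆V) = colour∈list x∉V

  colour<lists′ : ∀ {x y d} → x ∉ V′ → y ∈ V′ → d LM.∈ Ls′ y → colourOf (f′ x) < d
  colour<lists′ x∉V′ y∈V′ d∈Ls′ with removed x∉V′
  ... | inj₁ x∈U rewrite recoloured x∈U = above-c y∈V′ d∈Ls′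
  ... | inj₂ x∉V rewrite unrecoloured (x∉V ∘ U⊆V) =
    colour<lists x∉V (p─q⊆p V U y∈V′) (struck⊆ d∈Ls′)

  uniqueMax-completed : ∀ {S v} → S LM.∈ H → (∀ {x} → x ∈ S → x ∉ V′) → v ∈ S ∩ V →
    HasUniqueMax (colourOf ∘ f′) S
  uniqueMax-completed {S} {v} S∈H S-done v∈S∩V = v , v∈S , ≤top , top-unique
    where
    v∈S = proj₁ (x∈p∩q⁻ S V v∈S∩V)
    v∈V = proj₂ (x∈p∩q⁻ S V v∈S∩V)
    S∩V⊆U : ∀ {x} → x ∈ S → x ∈ V → x ∈ U
    S∩V⊆U x∈S x∈V with removed (S-done x∈S)
    ... | inj₁ x∈U = x∈U
    ... | inj₂ x∉V = ⊥-elim (x∉V x∈V)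
    v∈U = S∩V⊆U v∈S v∈V
    top : colourOf (f′ v) ≡ c
    top = cong colourOf (recoloured v∈U)
    in-U-or-below : ∀ {w} → w ∈ S → w ∈ U ⊎ colourOf (f′ w) < c
    in-U-or-below w∈S with removed (S-done w∈S)
    ... | inj₁ w∈U = inj₁ w∈U
    ... | inj₂ w∉V = inj₂ (subst (_< c) (cong colourOf (sym (unrecoloured (w∉V ∘ U⊆V))))
                                        (colour<lists w∉V v∈V (proj₂ (∈W⁻ (U⊆Vc v∈U)))))
    ≤top : ∀ w → w ∈ S → colourOf (f′ w) ≤ colourOf (f′ v)
    ≤top w w∈S with in-U-or-below w∈S
    ... | inj₁ w∈U = ≤-reflexive (trans (cong colourOf (recoloured w∈U)) (sym top))
    ... | inj₂ w<c = <⇒≤ (subst (colourOf (f′ w) <_) (sym top) w<c)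
    S∩W⊆U : S ∩ W ⊆ U
    S∩W⊆U x∈S∩W with x∈p∩q⁻ S W x∈S∩W
    ... | x∈S , x∈W = S∩V⊆U x∈S (proj₁ (∈W⁻ x∈W))
    top-unique : ∀ w → w ∈ S → colourOf (f′ w) ≡ colourOf (f′ v) → w ≡ v
    top-unique w w∈S w-top with in-U-or-below w∈S
    ... | inj₂ w<c = ⊥-elim (<-irrefl (trans w-top top) w<c)
    ... | inj₁ w∈U with w Fin.≟ v
    ...   | yes w≡v = w≡v
    ...   | no w≢v = ⊥-elim (U-indep (S ∩ W) (∈-map⁺ _ S∈H)
                               (two≤∣p∣ (x∈p∩q⁺ (w∈S , U⊆Vc w∈U)) (x∈p∩q⁺ (v∈S , U⊆Vc v∈U)) w≢v)
                               S∩W⊆U)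

  uniqueMax′ : ∀ {S} → S LM.∈ H → (∀ {x} → x ∈ S → x ∉ V′) → HasUniqueMax (colourOf ∘ f′) S
  uniqueMax′ {S} S∈H S-done with nonempty? (S ∩ V)
  ... | yes (v , v∈S∩V) = uniqueMax-completed S∈H S-done v∈S∩V
  ... | no S∩V-empty = HasUniqueMax-cong unchanged (uniqueMax S∈H S∉V)
    where
    S∉V : ∀ {x} → x ∈ S → x ∉ V
    S∉V x∈S x∈V = S∩V-empty (_ , x∈p∩q⁺ (x∈S , x∈V))
    unchanged : ∀ {w} → w ∈ S → colourOf (f w) ≡ colourOf (f′ w)
    unchanged w∈S = cong colourOf (sym (unrecoloured (S∉V w∈S ∘ U⊆V)))

  preserved : Invariant H L ⟨ V′ , Ls′ , f′ ⟩
  preserved = record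
    { coloured     = coloured′
    ; colour∈list  = colour∈list′
    ; lists⊆       = lists⊆ ∘ struck⊆
    ; colour<lists = colour<lists′
    ; uniqueMax    = uniqueMax′
    }

step-preserves : ∀ {n} {H : Hypergraph n} {L s s′} → Invariant H L s → Step H s s′ → Invariant H L s′
step-preserves inv (step _ _ _ (_ , c-lower) U⊆Vc U-indep) = Round.preserved inv c-lower U⊆Vc U-indep

run-preserves : ∀ {n} {H : Hypergraph n} {L s s′} → Invariant H L s → Star (GoodStep H) s s′ → Invariant H L s′
run-preserves inv ε = inv
run-preserves inv ((st , _) ◅ run) = run-preserves (step-preserves inv st) run

mainTheorem2 : ∀ (n : ℕ) (H : Hypergraph n) (L : Fin n → List ℕ) (f : Fin n → Maybe ℕ) →
    (∀ S → S LM.∈ H → Nonempty S) →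
    (∀ v → All (0 <_) (L v)) →
    CompleteRun H L f →
    Σ (Fin n → ℕ) λ g →
      (∀ v → f v ≡ just (g v))
      × (∀ v → 0 < g v)
      × (∀ v → g v LM.∈ L v)
      × IsUniqueMaxColoring H g
mainTheorem2 n H L f edges-nonempty positive (_ , _ , run , refl , refl) =
  colourOf ∘ f
  , (λ v → coloured ∉⊥)
  , (λ v → All.lookup (positive v) (colour∈list ∉⊥))
  , (λ v → colour∈list ∉⊥)
  , (λ S S∈H → uniqueMax S∈H (λ _ → ∉⊥))
  where open Invariant (run-preserves (initial-invariant edges-nonempty) run)
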